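{- Let $H=(V,E)$ be a linear hypergraph with $n$ vertices, and let $E=E_1\sqcup E_2$ be a partition of its edge set into nonempty sets. Let $P_1=\max_{e_1\in E_1}|e_1|$ and $\rho_2=\min_{e_2\in E_2}|e_2|$, and assume $\rho_2\geq 2$. Then $$q_{\text{list}}(H)\leq \max\Bigl(q_{\text{list}}(E_2),\; q_{\text{list}}(E_1)+\frac{(n-1)P_1}{\rho_2-1}\Bigr).$$
   Context: A hypergraph $H=(V,E)$ has vertex set $V$ and edges that are subsets of $V$; it is linear if any two distinct edges share at most one vertex. The line graph $L(H)$ is the graph on vertex set $E$ with $e_1,e_2$ adjacent iff $e_1\cap e_2\neq\emptyset$, and $q_{\text{list}}(H)$ is the list chromatic number of $L(H)$. For $E'\subseteq E$, $q_{\text{list}}(E')$ denotes $q_{\text{list}}$ of the hypergraph $(V,E')$. -}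

module Defs where

open import Data.Nat using (ℕ; _≤_; _<_)
open import Data.Fin using (Fin)
open import Data.Fin.Subset using (Subset; _∈_; _∩_; ∣_∣)
open import Data.List using (List; length)
open import Data.List.Relation.Unary.Unique.Propositional using (Unique)
import Data.List.Membership.Propositional as LM
open import Data.Product using (Σ; ∃; ∃-syntax; _×_)
open import Relation.Binary.PropositionalEquality using (_≡_; _≢_)
open import Relation.Nullary using (¬_)
open import Function.Definitions using (Injective)

-- A hypergraph on vertex set Fin n with m edges is given by an edge family
--   edge : Fin m → Subset n.
-- The edge set is a *set*, so we require the family to be injective
-- (distinct indices are distinct edges).
DistinctEdges : ∀ {n m} → (Fin m → Subset n) → Set
DistinctEdges edge = Injective _≡_ _≡_ edge

Linear : ∀ {n m} → (Fin m → Subset n) → Set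
Linear edge = ∀ i j → i ≢ j → ∣ edge i ∩ edge j ∣ ≤ 1

-- Two edges intersect (adjacency in the line graph).
Meet : ∀ {n} → Subset n → Subset n → Set
Meet {n} e f = ∃[ v ] (v ∈ e × v ∈ f)

-- The sub-hypergraph (V, E') with E' = { edge i | S i } is k-choosable in the
-- line-graph sense: for every list assignment giving each edge of E' a list of
-- at least k distinct colours (colours are natural numbers), there is a
-- colouring of the edges of E' from their lists in which intersecting distinct
-- edges get different colours.
LineChoosable : ∀ {n m} → (Fin m → Subset n) → (Fin m → Set) → ℕ → Set
LineChoosable {n} {m} edge S k =
  (L : Fin m → List ℕ) →
  (∀ i → S i → Unique (L i) × k ≤ length (L i)) →
  Σ (Fin m → ℕ) λ c →
    (∀ i → S i → c i LM.∈ L i) ×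
    (∀ i j → S i → S j → i ≢ j → Meet (edge i) (edge j) → c i ≢ c j)

-- q is the list chromatic number of the line graph of (V, E'):
-- the least k for which the line graph is k-choosable.
IsQList : ∀ {n m} → (Fin m → Subset n) → (Fin m → Set) → ℕ → Set
IsQList edge S q = LineChoosable edge S q × (∀ k → k < q → ¬ LineChoosable edge S k)

IsMaxSize : ∀ {n m} → (Fin m → Subset n) → (Fin m → Set) → ℕ → Set
IsMaxSize edge S P = (∃[ i ] (S i × ∣ edge i ∣ ≡ P)) × (∀ i → S i → ∣ edge i ∣ ≤ P)

IsMinSize : ∀ {n m} → (Fin m → Subset n) → (Fin m → Set) → ℕ → Set
IsMinSize edge S ρ = (∃[ i ] (S i × ∣ edge i ∣ ≡ ρ)) × (∀ i → S i → ρ ≤ ∣ edge i ∣)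

module Submission where

open import Defs
open import Data.Nat using (ℕ; zero; suc; _≤_; _*_; _+_; _∸_; _⊔_; z≤n; s≤s; NonZero; >-nonZero)
open import Data.Nat.Properties
  using (_≟_; +-*-semiring; module ≤-Reasoning; ≤-trans; ≤-reflexive; <⇒≱; ≮⇒≥; m≤m+n; m≤m⊔n; m≤n⊔m;
         +-suc; +-mono-≤; +-monoˡ-≤; +-monoʳ-≤; +-cancelʳ-≤; *-monoˡ-≤; *-monoʳ-≤; ∸-monoˡ-≤; ⊔-monoʳ-≤;
         *-comm; *-assoc; *-identityʳ; *-distribʳ-+; *-distribʳ-⊔)
open import Data.Nat.DivMod using (_/_; m/n*n≤m; m*n/n≡m; /-monoˡ-≤)
open import Data.Bool using (Bool; true; false; if_then_else_) renaming (_≟_ to _≟ᵇ_)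
open import Data.Fin using (Fin; zero; suc; punchIn)
open import Data.Fin.Properties using (any?; 0≢1+n; punchInᵢ≢i; suc-injective) renaming (_≟_ to _≟ᶠ_)
open import Data.Fin.Subset using (Subset; _∈_; ∣_∣; outside; inside)
open import Data.Vec using ([]; _∷_)
open import Data.Fin.Subset.Properties using (_∈?_; x∈p∩q⁺; x∈p∧x≢y⇒x∈p-y; x∈p⇒∣p-x∣<∣p∣)
open import Data.List using (List; []; _∷_; _++_; length; map; filter; tabulate; allFin)
open import Data.List.Properties using (length-map; length-++-sucʳ)
open import Data.List.Membership.Propositional using () renaming (_∈_ to _∈ˡ_)
open import Data.List.Membership.Propositional.Properties
  using (∈-filter⁺; ∈-filter⁻; ∈-map⁺; ∈-allFin; ∈-∃++; ∈-++⁻; ∈-++⁺ˡ; ∈-++⁺ʳ)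
open import Data.List.Membership.DecPropositional _≟_ using () renaming (_∈?_ to _∈ˡ?_; _∉?_ to _∉ˡ?_)
import Data.List.Relation.Unary.All as All
open import Data.List.Relation.Unary.Any using (here; there)
open import Data.List.Relation.Unary.AllPairs using (_∷_)
open import Data.List.Relation.Unary.Unique.Propositional using (Unique)
open import Data.List.Relation.Unary.Unique.Propositional.Properties using (filter⁺)
open import Data.Product using (Σ; ∃-syntax; _×_; _,_; proj₁; proj₂)
open import Data.Sum using (inj₁; inj₂)
open import Data.Unit using (⊤; tt)
open import Data.Empty using (⊥-elim)
open import Function using (_∘_)
open import Relation.Nullary using (Dec; does; yes; no; ¬_; ¬?)
open import Relation.Nullary.Decidable using (_×-dec_)
open import Relation.Unary using (Decidable)
open import Relation.Binary.PropositionalEquality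
open import Algebra.Properties.Semiring.Sum +-*-semiring
  using (sum; sum-syntax; ∑-comm; sum-remove; sum-cong-≗; *-distribˡ-sum; *-distribʳ-sum)

-- Put k = q₂ ⊔ (q₁ + D) with D = ⌊(n-1)P₁ / (ρ₂-1)⌋; we show that
-- the line graph of H is k-choosable, whence q ≤ k and the claim follows by
-- multiplying out.  Given lists of ≥ k colours, first colour E₂ from its lists
-- (possible since k ≥ q₂).  Every E₁-edge e then deletes from its list the
-- colours of the E₂-edges meeting it; if there are at most D of them, at least
-- q₁ colours remain and E₁ can be coloured from the shortened lists.
-- The bound D is a double count using linearity: the E₂-edges through a vertex
-- v pairwise meet only in v, and each has ≥ ρ₂-1 further vertices, so v lies in
-- at most (n-1)/(ρ₂-1) of them; summing over the ≤ P₁ vertices of e bounds the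
-- number of E₂-edges meeting e by (n-1)P₁/(ρ₂-1).

χ : ∀ {A : Set} → Dec A → ℕ
χ d = if does d then 1 else 0

count : ∀ {k} {P : Fin k → Set} → Decidable P → ℕ
count {k} P? = ∑[ i < k ] χ (P? i)

χ-yes : ∀ {A : Set} (d : Dec A) → A → χ d ≡ 1
χ-yes (yes _) _ = refl
χ-yes (no ¬a) a = ⊥-elim (¬a a)

χ-× : ∀ {A B : Set} (a : Dec A) (b : Dec B) → χ a * χ b ≡ χ (a ×-dec b)
χ-× (yes _) (yes _) = refl
χ-× (yes _) (no _) = refl
χ-× (no _) _ = refl

χ-≤ : ∀ {A : Set} (d : Dec A) {y} → (A → 1 ≤ y) → χ d ≤ y
χ-≤ (yes a) 1≤y = 1≤y a
χ-≤ (no _) _ = z≤n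

χ-*-mono : ∀ {A : Set} (d : Dec A) {x y} → (A → x ≤ y) → χ d * x ≤ χ d * y
χ-*-mono (yes a) x≤y = +-monoˡ-≤ 0 (x≤y a)
χ-*-mono (no _) _ = z≤n

∑-mono : ∀ {k} {f g : Fin k → ℕ} → (∀ i → f i ≤ g i) → sum f ≤ sum g
∑-mono {zero} _ = z≤n
∑-mono {suc k} f≤g = +-mono-≤ (f≤g zero) (∑-mono (f≤g ∘ suc))

∑-bounded : ∀ {k c} {f : Fin k → ℕ} → (∀ i → f i ≤ c) → sum f ≤ k * c
∑-bounded {zero} _ = z≤n
∑-bounded {suc k} f≤c = +-mono-≤ (f≤c zero) (∑-bounded (f≤c ∘ suc))

term≤∑ : ∀ {k} (f : Fin k → ℕ) (i : Fin k) → f i ≤ sum f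
term≤∑ {suc k} f i = ≤-trans (m≤m+n (f i) _) (≤-reflexive (sym (sum-remove {i = i} f)))

count-none : ∀ {k} {P : Fin k → Set} (P? : Decidable P) → (∀ i → ¬ P i) → count P? ≡ 0
count-none {zero} _ _ = refl
count-none {suc k} P? none with P? zero
... | yes p = ⊥-elim (none zero p)
... | no _ = count-none (P? ∘ suc) (none ∘ suc)

count-atMostOne : ∀ {k} {P : Fin k → Set} (P? : Decidable P) →
                  (∀ {i j} → P i → P j → i ≡ j) → count P? ≤ 1
count-atMostOne {zero} _ _ = z≤n
count-atMostOne {suc k} P? unique with P? zero
... | yes p₀ = s≤s (≤-reflexive (count-none (P? ∘ suc) (λ i pᵢ → 0≢1+n (unique p₀ pᵢ))))
... | no _ = count-atMostOne (P? ∘ suc) (λ pᵢ pⱼ → suc-injective (unique pᵢ pⱼ))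

length-filter-tabulate : ∀ {A : Set} {k} {P : A → Set} (P? : Decidable P) (f : Fin k → A) →
                         length (filter P? (tabulate f)) ≡ count (P? ∘ f)
length-filter-tabulate {k = zero} _ _ = refl
length-filter-tabulate {k = suc k} P? f with P? (f zero)
... | yes _ = cong suc (length-filter-tabulate P? (f ∘ suc))
... | no _ = length-filter-tabulate P? (f ∘ suc)

∣∣≡count : ∀ {n} (s : Subset n) → ∣ s ∣ ≡ count (_∈? s)
∣∣≡count [] = refl
∣∣≡count (inside ∷ s) = cong suc (∣∣≡count s)
∣∣≡count (outside ∷ s) = ∣∣≡count s

∣∣-split : ∀ {n} (s : Subset (suc n)) (v : Fin (suc n)) →
           ∣ s ∣ ≡ χ (v ∈? s) + count (λ u → punchIn v u ∈? s)
∣∣-split s v = trans (∣∣≡count s) (sum-remove {i = v} (λ w → χ (w ∈? s)))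

two-points : ∀ {n} {p : Subset n} {x y : Fin n} → x ∈ p → y ∈ p → x ≢ y → 2 ≤ ∣ p ∣
two-points x∈p y∈p x≢y =
  ≤-trans (s≤s (nonempty (x∈p∧x≢y⇒x∈p-y y∈p (x≢y ∘ sym)))) (x∈p⇒∣p-x∣<∣p∣ x∈p)
  where
  nonempty : ∀ {n} {q : Subset n} {z} → z ∈ q → 1 ≤ ∣ q ∣
  nonempty z∈q = ≤-trans (s≤s z≤n) (x∈p⇒∣p-x∣<∣p∣ z∈q)

common-vertex-unique : ∀ {n m} {edge : Fin m → Subset n} → Linear edge →
                       ∀ {i j v w} → i ≢ j → v ∈ edge i → v ∈ edge j → w ∈ edge i → w ∈ edge j → v ≡ w
common-vertex-unique linear {i} {j} {v} {w} i≢j v∈i v∈j w∈i w∈j with v ≟ᶠ w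
... | yes v≡w = v≡w
... | no v≢w = ⊥-elim (<⇒≱ (two-points (x∈p∩q⁺ (v∈i , v∈j)) (x∈p∩q⁺ (w∈i , w∈j)) v≢w) (linear i j i≢j))

meet? : ∀ {n m} (edge : Fin m → Subset n) (i j : Fin m) → Dec (Meet (edge i) (edge j))
meet? edge i j = any? (λ v → v ∈? edge i ×-dec v ∈? edge j)

degree : ∀ {n m} (edge : Fin m → Subset n) {S : Fin m → Set} → Decidable S → Fin n → ℕ
degree edge S? v = count (λ j → S? j ×-dec v ∈? edge j)

neighbours : ∀ {n m} (edge : Fin m → Subset n) {S : Fin m → Set} → Decidable S → Fin m → ℕ
neighbours edge S? i = count (λ j → S? j ×-dec meet? edge i j)

meeting : ∀ {n m} (edge : Fin m → Subset n) {S : Fin m → Set} → Decidable S → Fin m → List (Fin m)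
meeting {m = m} edge S? i = filter (λ j → S? j ×-dec meet? edge i j) (allFin m)

length-meeting : ∀ {n m} (edge : Fin m → Subset n) {S : Fin m → Set} (S? : Decidable S) i →
                 length (meeting edge S? i) ≡ neighbours edge S? i
length-meeting edge S? i = length-filter-tabulate (λ j → S? j ×-dec meet? edge i j) (λ j → j)

∈-meeting : ∀ {n m} (edge : Fin m → Subset n) {S : Fin m → Set} (S? : Decidable S) {i j} →
            S j → Meet (edge i) (edge j) → j ∈ˡ meeting edge S? i
∈-meeting edge S? {i} {j} sⱼ meet = ∈-filter⁺ (λ j → S? j ×-dec meet? edge i j) (∈-allFin j) (sⱼ , meet)

-- Degree bound: if all S-edges have at least ρ vertices, then in a linear
-- hypergraph the S-edges through v have pairwise disjoint sets of ≥ ρ-1 further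
-- vertices, so there are at most (n-1)/(ρ-1) of them.
degree-bound : ∀ {n m} (edge : Fin m → Subset n) → Linear edge →
               ∀ {S : Fin m → Set} (S? : Decidable S) {ρ} → (∀ j → S j → ρ ≤ ∣ edge j ∣) →
               ∀ v → degree edge S? v * (ρ ∸ 1) ≤ n ∸ 1
degree-bound {suc n} {m} edge linear {S} S? {ρ} large v = begin
  degree edge S? v * (ρ ∸ 1)              ≡⟨ *-distribʳ-sum (ρ ∸ 1) (χ ∘ through) ⟩
  ∑[ j < m ] (χ (through j) * (ρ ∸ 1))    ≤⟨ ∑-mono others-large ⟩
  ∑[ j < m ] (χ (through j) * others j)   ≡⟨ sum-cong-≗ (λ j → *-distribˡ-sum (χ (through j)) (other j)) ⟩
  ∑[ j < m ] ∑[ u < n ] incidence j u     ≡⟨ ∑-comm incidence ⟩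
  ∑[ u < n ] ∑[ j < m ] incidence j u     ≤⟨ ∑-bounded other-vertex-once ⟩
  n * 1                                   ≡⟨ *-identityʳ n ⟩
  n                                       ∎
  where
  open ≤-Reasoning
  through : ∀ j → Dec (S j × v ∈ edge j)
  through j = S? j ×-dec v ∈? edge j
  -- the vertices other than v are punchIn v u for u : Fin n
  other : Fin m → Fin n → ℕ
  other j u = χ (punchIn v u ∈? edge j)
  others : Fin m → ℕ
  others j = ∑[ u < n ] other j u
  incidence : Fin m → Fin n → ℕ
  incidence j u = χ (through j) * other j u
  others-large : ∀ j → χ (through j) * (ρ ∸ 1) ≤ χ (through j) * others j
  others-large j = χ-*-mono (through j) λ (sⱼ , v∈j) → ∸-monoˡ-≤ 1 (begin
    ρ                                  ≤⟨ large j sⱼ ⟩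
    ∣ edge j ∣                         ≡⟨ ∣∣-split (edge j) v ⟩
    χ (v ∈? edge j) + others j         ≡⟨ cong (_+ others j) (χ-yes (v ∈? edge j) v∈j) ⟩
    suc (others j)                     ∎)
  -- by linearity, a vertex w ≠ v lies in at most one S-edge through v
  other-vertex-once : ∀ u → ∑[ j < m ] incidence j u ≤ 1
  other-vertex-once u = begin
    ∑[ j < m ] incidence j u                   ≡⟨ sum-cong-≗ (λ j → χ-× (through j) (w ∈? edge j)) ⟩
    count (λ j → through j ×-dec w ∈? edge j)  ≤⟨ count-atMostOne (λ j → through j ×-dec w ∈? edge j) same-edge ⟩
    1                                          ∎
    where
    w : Fin (suc n)
    w = punchIn v u
    same-edge : ∀ {i j} → (S i × v ∈ edge i) × w ∈ edge i → (S j × v ∈ edge j) × w ∈ edge j → i ≡ j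
    same-edge {i} {j} ((_ , v∈i) , w∈i) ((_ , v∈j) , w∈j) with i ≟ᶠ j
    ... | yes i≡j = i≡j
    ... | no i≢j = ⊥-elim (punchInᵢ≢i v u (sym (common-vertex-unique linear i≢j v∈i v∈j w∈i w∈j)))

-- Neighbourhood bound: an edge e meets at most ∣e∣(n-1)/(ρ-1) edges of S, since
-- each S-edge meeting e passes through one of the vertices of e.
neighbour-bound : ∀ {n m} (edge : Fin m → Subset n) → Linear edge →
                  ∀ {S : Fin m → Set} (S? : Decidable S) {ρ} → (∀ j → S j → ρ ≤ ∣ edge j ∣) →
                  ∀ i → neighbours edge S? i * (ρ ∸ 1) ≤ ∣ edge i ∣ * (n ∸ 1)
neighbour-bound {n} {m} edge linear S? {ρ} large i = begin
  neighbours edge S? i * (ρ ∸ 1)                 ≤⟨ *-monoˡ-≤ (ρ ∸ 1) union-bound ⟩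
  (∑[ v < n ] (inᵢ v * deg v)) * (ρ ∸ 1)         ≡⟨ *-distribʳ-sum (ρ ∸ 1) (λ v → inᵢ v * deg v) ⟩
  ∑[ v < n ] (inᵢ v * deg v * (ρ ∸ 1))           ≡⟨ sum-cong-≗ (λ v → *-assoc (inᵢ v) (deg v) (ρ ∸ 1)) ⟩
  ∑[ v < n ] (inᵢ v * (deg v * (ρ ∸ 1)))         ≤⟨ ∑-mono (λ v → *-monoʳ-≤ (inᵢ v) (degree-bound edge linear S? large v)) ⟩
  ∑[ v < n ] (inᵢ v * (n ∸ 1))                   ≡⟨ *-distribʳ-sum (n ∸ 1) inᵢ ⟨
  count (_∈? edge i) * (n ∸ 1)                   ≡⟨ cong (_* (n ∸ 1)) (∣∣≡count (edge i)) ⟨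
  ∣ edge i ∣ * (n ∸ 1)                            ∎
  where
  open ≤-Reasoning
  inᵢ : Fin n → ℕ
  inᵢ v = χ (v ∈? edge i)
  deg : Fin n → ℕ
  deg = degree edge S?
  incidence : Fin m → Fin n → ℕ
  incidence j v = inᵢ v * χ (S? j ×-dec v ∈? edge j)
  -- an S-edge meeting edge i contributes to the degree of a common vertex
  via-common-vertex : ∀ j → χ (S? j ×-dec meet? edge i j) ≤ ∑[ v < n ] incidence j v
  via-common-vertex j = χ-≤ (S? j ×-dec meet? edge i j) λ (sⱼ , v , v∈i , v∈j) → ≤-trans
    (≤-reflexive (sym (cong₂ _*_ (χ-yes (v ∈? edge i) v∈i) (χ-yes (S? j ×-dec v ∈? edge j) (sⱼ , v∈j)))))
    (term≤∑ (incidence j) v)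
  union-bound : neighbours edge S? i ≤ ∑[ v < n ] (inᵢ v * deg v)
  union-bound = begin
    neighbours edge S? i               ≤⟨ ∑-mono via-common-vertex ⟩
    ∑[ j < m ] ∑[ v < n ] incidence j v ≡⟨ ∑-comm incidence ⟩
    ∑[ v < n ] ∑[ j < m ] incidence j v ≡⟨ sum-cong-≗ (λ v → *-distribˡ-sum (inᵢ v) (λ j → χ (S? j ×-dec v ∈? edge j))) ⟨
    ∑[ v < n ] (inᵢ v * deg v)         ∎

length-filter-split : ∀ {A : Set} {P : A → Set} (P? : Decidable P) (xs : List A) →
                      length xs ≡ length (filter (¬? ∘ P?) xs) + length (filter P? xs)
length-filter-split P? [] = refl
length-filter-split P? (x ∷ xs) with P? x
... | yes _ = trans (cong suc (length-filter-split P? xs)) (sym (+-suc _ _))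
... | no _ = cong suc (length-filter-split P? xs)

unique-⊆-length : ∀ {A : Set} {xs ys : List A} → Unique xs → (∀ {x} → x ∈ˡ xs → x ∈ˡ ys) →
                  length xs ≤ length ys
unique-⊆-length {xs = []} _ _ = z≤n
unique-⊆-length {xs = x ∷ xs} (x∉xs ∷ unique) xs⊆ys with ∈-∃++ (xs⊆ys (here refl))
... | as , bs , refl = begin
  suc (length xs)          ≤⟨ s≤s (unique-⊆-length unique xs⊆as++bs) ⟩
  suc (length (as ++ bs))  ≡⟨ length-++-sucʳ as x bs ⟨
  length (as ++ x ∷ bs)    ∎
  where
  open ≤-Reasoning
  xs⊆as++bs : ∀ {y} → y ∈ˡ xs → y ∈ˡ as ++ bs
  xs⊆as++bs {y} y∈xs with ∈-++⁻ as (xs⊆ys (there y∈xs))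
  ... | inj₁ y∈as = ∈-++⁺ˡ y∈as
  ... | inj₂ (here refl) = ⊥-elim (All.lookup x∉xs y∈xs refl)
  ... | inj₂ (there y∈bs) = ∈-++⁺ʳ as y∈bs

residual-list : ∀ {q} (xs ys : List ℕ) → Unique xs → q + length ys ≤ length xs →
                Unique (filter (_∉ˡ? ys) xs) × q ≤ length (filter (_∉ˡ? ys) xs)
residual-list {q} xs ys unique long = filter⁺ (_∉ˡ? ys) unique , +-cancelʳ-≤ (length ys) q _ (begin
  q + length ys                                                 ≤⟨ long ⟩
  length xs                                                     ≡⟨ length-filter-split (_∈ˡ? ys) xs ⟩
  length (filter (_∉ˡ? ys) xs) + length (filter (_∈ˡ? ys) xs)     ≤⟨ +-monoʳ-≤ _ deleted-few ⟩
  length (filter (_∉ˡ? ys) xs) + length ys                       ∎)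
  where
  open ≤-Reasoning
  deleted-few : length (filter (_∈ˡ? ys) xs) ≤ length ys
  deleted-few = unique-⊆-length (filter⁺ (_∈ˡ? ys) unique) (proj₂ ∘ ∈-filter⁻ (_∈ˡ? ys) {xs = xs})

ListColouring : ∀ {n m} → (Fin m → Subset n) → (Fin m → Set) → (Fin m → List ℕ) → Set
ListColouring {m = m} edge S L = Σ (Fin m → ℕ) λ c →
  (∀ i → S i → c i ∈ˡ L i) × (∀ i j → S i → S j → i ≢ j → Meet (edge i) (edge j) → c i ≢ c j)

-- Gluing a colouring c₁ of E₁ (part true) and c₂ of E₂ (part false).
glue : ∀ {m} → (Fin m → Bool) → (Fin m → ℕ) → (Fin m → ℕ) → Fin m → ℕ
glue part c₁ c₂ i = if part i then c₁ i else c₂ i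

glue-proper : ∀ {n m} (edge : Fin m → Subset n) (part : Fin m → Bool) (c₁ c₂ : Fin m → ℕ) →
  (∀ i j → part i ≡ true → part j ≡ true → i ≢ j → Meet (edge i) (edge j) → c₁ i ≢ c₁ j) →
  (∀ i j → part i ≡ false → part j ≡ false → i ≢ j → Meet (edge i) (edge j) → c₂ i ≢ c₂ j) →
  (∀ i j → part i ≡ true → part j ≡ false → Meet (edge i) (edge j) → c₁ i ≢ c₂ j) →
  ∀ i j → i ≢ j → Meet (edge i) (edge j) → glue part c₁ c₂ i ≢ glue part c₁ c₂ j
glue-proper edge part c₁ c₂ proper₁ proper₂ apart i j i≢j meet with part i in pᵢ | part j in pⱼ
... | true  | true  = proper₁ i j pᵢ pⱼ i≢j meet
... | false | false = proper₂ i j pᵢ pⱼ i≢j meet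
... | true  | false = apart i j pᵢ pⱼ meet
... | false | true  = apart j i pⱼ pᵢ (let v , v∈i , v∈j = meet in v , v∈j , v∈i) ∘ sym

-- Extension lemma: if every E₁-edge meets at most D edges of E₂ (all listed
-- in blockers), then H is (q₂ ⊔ (q₁ + D))-choosable: colour E₂ first, then
-- colour E₁ from its lists with the colours of the meeting E₂-edges deleted.
choosable-extension : ∀ {n m} (edge : Fin m → Subset n) (part : Fin m → Bool) {q₁ q₂ D : ℕ}
  (blockers : Fin m → List (Fin m)) →
  (∀ i j → part i ≡ true → part j ≡ false → Meet (edge i) (edge j) → j ∈ˡ blockers i) →
  (∀ i → part i ≡ true → length (blockers i) ≤ D) →
  LineChoosable edge (λ i → part i ≡ true) q₁ →
  LineChoosable edge (λ i → part i ≡ false) q₂ →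
  LineChoosable edge (λ _ → ⊤) (q₂ ⊔ (q₁ + D))
choosable-extension {m = m} edge part {q₁} {q₂} {D} blockers blocked few choosable₁ choosable₂ L long =
  glue part c₁ c₂ , glue∈L , λ i j _ _ → glue-proper edge part c₁ c₂ (proj₂ (proj₂ colouring₁)) (proj₂ (proj₂ colouring₂)) apart i j
  where
  long₂ : ∀ i → part i ≡ false → Unique (L i) × q₂ ≤ length (L i)
  long₂ i _ = proj₁ (long i tt) , ≤-trans (m≤m⊔n q₂ (q₁ + D)) (proj₂ (long i tt))
  colouring₂ : ListColouring edge (λ i → part i ≡ false) L
  colouring₂ = choosable₂ L long₂
  c₂ : Fin m → ℕ
  c₂ = proj₁ colouring₂
  forbidden : Fin m → List ℕ
  forbidden i = map c₂ (blockers i)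
  L₁ : Fin m → List ℕ
  L₁ i = filter (_∉ˡ? forbidden i) (L i)
  long₁ : ∀ i → part i ≡ true → Unique (L₁ i) × q₁ ≤ length (L₁ i)
  long₁ i pᵢ = residual-list (L i) (forbidden i) (proj₁ (long i tt)) (begin
    q₁ + length (forbidden i)  ≡⟨ cong (q₁ +_) (length-map c₂ (blockers i)) ⟩
    q₁ + length (blockers i)   ≤⟨ +-monoʳ-≤ q₁ (few i pᵢ) ⟩
    q₁ + D                     ≤⟨ m≤n⊔m q₂ (q₁ + D) ⟩
    q₂ ⊔ (q₁ + D)              ≤⟨ proj₂ (long i tt) ⟩
    length (L i)               ∎)
    where open ≤-Reasoning
  colouring₁ : ListColouring edge (λ i → part i ≡ true) L₁
  colouring₁ = choosable₁ L₁ long₁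
  c₁ : Fin m → ℕ
  c₁ = proj₁ colouring₁
  c₁-allowed : ∀ i → part i ≡ true → c₁ i ∈ˡ L i × ¬ c₁ i ∈ˡ forbidden i
  c₁-allowed i pᵢ = ∈-filter⁻ (_∉ˡ? forbidden i) {xs = L i} (proj₁ (proj₂ colouring₁) i pᵢ)
  glue∈L : ∀ i → ⊤ → glue part c₁ c₂ i ∈ˡ L i
  glue∈L i _ with part i in pᵢ
  ... | true  = proj₁ (c₁-allowed i pᵢ)
  ... | false = proj₁ (proj₂ colouring₂) i pᵢ
  apart : ∀ i j → part i ≡ true → part j ≡ false → Meet (edge i) (edge j) → c₁ i ≢ c₂ j
  apart i j pᵢ pⱼ meet c₁i≡c₂j = proj₂ (c₁-allowed i pᵢ)
    (subst (_∈ˡ forbidden i) (sym c₁i≡c₂j) (∈-map⁺ c₂ (blocked i j pᵢ pⱼ meet)))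

qlist-≤ : ∀ {n m} {edge : Fin m → Subset n} {S : Fin m → Set} {q k} →
          IsQList edge S q → LineChoosable edge S k → q ≤ k
qlist-≤ {k = k} (_ , least) choosable = ≮⇒≥ (λ k<q → least k k<q choosable)

≤-floor : ∀ {a X} r .{{_ : NonZero r}} → a * r ≤ X → a ≤ X / r
≤-floor {a} {X} r a*r≤X = begin
  a          ≡⟨ m*n/n≡m a r ⟨
  a * r / r  ≤⟨ /-monoˡ-≤ r a*r≤X ⟩
  X / r      ∎
  where open ≤-Reasoning

⊔-floor-bound : ∀ {q} a b X r .{{_ : NonZero r}} → q ≤ a ⊔ (b + X / r) → q * r ≤ (a * r) ⊔ (b * r + X)
⊔-floor-bound {q} a b X r q≤ = begin
  q * r                        ≤⟨ *-monoˡ-≤ r q≤ ⟩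
  (a ⊔ (b + X / r)) * r        ≡⟨ *-distribʳ-⊔ r a (b + X / r) ⟩
  (a * r) ⊔ ((b + X / r) * r)  ≡⟨ cong ((a * r) ⊔_) (*-distribʳ-+ r b (X / r)) ⟩
  (a * r) ⊔ (b * r + X / r * r) ≤⟨ ⊔-monoʳ-≤ (a * r) (+-monoʳ-≤ (b * r) (m/n*n≤m X r)) ⟩
  (a * r) ⊔ (b * r + X)        ∎
  where open ≤-Reasoning

proposition1 : (n m : ℕ) (edge : Fin m → Subset n) →
    DistinctEdges edge → Linear edge →
    (part : Fin m → Bool) →
    (∃[ i ] (part i ≡ true)) → (∃[ i ] (part i ≡ false)) →
    (P₁ ρ₂ : ℕ) →
    IsMaxSize edge (λ i → part i ≡ true) P₁ →
    IsMinSize edge (λ i → part i ≡ false) ρ₂ →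
    2 ≤ ρ₂ →
    (q q₁ q₂ : ℕ) →
    IsQList edge (λ _ → ⊤) q →
    IsQList edge (λ i → part i ≡ true) q₁ →
    IsQList edge (λ i → part i ≡ false) q₂ →
    q * (ρ₂ ∸ 1) ≤ (q₂ * (ρ₂ ∸ 1)) ⊔ (q₁ * (ρ₂ ∸ 1) + (n ∸ 1) * P₁)
proposition1 n m edge _ linear part _ _ P₁ ρ₂ (_ , E₁-small) (_ , E₂-large) 2≤ρ₂
             q q₁ q₂ q-least (choosable₁ , _) (choosable₂ , _) =
  ⊔-floor-bound q₂ q₁ ((n ∸ 1) * P₁) (ρ₂ ∸ 1) (qlist-≤ q-least choosable)
  where
  instance
    ρ₂-1≢0 : NonZero (ρ₂ ∸ 1)
    ρ₂-1≢0 = >-nonZero (∸-monoˡ-≤ 1 2≤ρ₂)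
  E₂? : Decidable (λ j → part j ≡ false)
  E₂? j = part j ≟ᵇ false
  few : ∀ i → part i ≡ true → length (meeting edge E₂? i) ≤ (n ∸ 1) * P₁ / (ρ₂ ∸ 1)
  few i pᵢ = ≤-floor (ρ₂ ∸ 1) (begin
    length (meeting edge E₂? i) * (ρ₂ ∸ 1)  ≡⟨ cong (_* (ρ₂ ∸ 1)) (length-meeting edge E₂? i) ⟩
    neighbours edge E₂? i * (ρ₂ ∸ 1)        ≤⟨ neighbour-bound edge linear E₂? E₂-large i ⟩
    ∣ edge i ∣ * (n ∸ 1)                    ≤⟨ *-monoˡ-≤ (n ∸ 1) (E₁-small i pᵢ) ⟩
    P₁ * (n ∸ 1)                            ≡⟨ *-comm P₁ (n ∸ 1) ⟩
    (n ∸ 1) * P₁                            ∎)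
    where open ≤-Reasoning
  choosable : LineChoosable edge (λ _ → ⊤) (q₂ ⊔ (q₁ + (n ∸ 1) * P₁ / (ρ₂ ∸ 1)))
  choosable = choosable-extension edge part (meeting edge E₂?) (λ _ _ _ pⱼ → ∈-meeting edge E₂? pⱼ)
                                  few choosable₁ choosable₂
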